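{- Let $\mathcal G=(S,S^0,S^1,S^R,\to,P,\mathrm{Col})$ be a game of rank $n$ and $x=n\bmod 2$. Then $\mathcal C_n(\mathcal G)$ is a $(1-x)$-trap.
   Context: A game of rank $n$ is a tuple $\mathcal G=(S,S^0,S^1,S^R,\to,P,\mathrm{Col})$: states $S$ partitioned into $S^0$ (Player 0), $S^1$ (Player 1), $S^R$ (random); $\to\subseteq S\times S$ with every state having at least one and at most countably many successors; $P:S^R\times S\to[0,1]$ with $P(s,s')>0$ iff $s\to s'$ and $\sum_{s'}P(s,s')=1$; $\mathrm{Col}:S\to\{0,\dots,n\}$. A set $Q$ is sink-free if every $s\in Q$ has a successor in $Q$; closable if sink-free and all successors of states in $Q\cap S^R$ lie in $Q$; a $y$-trap if closable and all successors of states in $Q\cap S^y$ lie in $Q$. Let $\mathrm{Pre}(Q)=\{s:\exists s'\in Q,\ s\to s'\}$, $\widetilde{\mathrm{Pre}}(Q)=S\setminus\mathrm{Pre}(S\setminus Q)$. For $y\in\{0,1\}$, $T\subseteq S$: $R_0=T$, $R_{\alpha+1}=R_\alpha\cup(S^R\cap\mathrm{Pre}(R_\alpha))\cup(S^y\cap\mathrm{Pre}(R_\alpha))\cup(S^{1-y}\cap\widetilde{\mathrm{Pre}}(R_\alpha))$, $R_\lambda=\bigcup_{\alpha<\lambda}R_\alpha$ for limit $\lambda$, and $\mathrm{Force}^y(\mathcal G,T)=R_\gamma$ for the least $\gamma$ with $R_\gamma=R_{\gamma+1}$. If $S\setminus Q$ is closable, the sub-game $\mathcal G\ominus Q$ has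 state set $S'=S\setminus Q$, player sets intersected with $S'$, transitions $\to\cap(S'\times S')$, and $P,\mathrm{Col}$ restricted to $S'$. Define $\mathcal C_0(\mathcal G)=S$; for $n\ge1$, $x=n\bmod 2$, define transfinitely $\mathcal X_\alpha=\mathrm{Force}^{1-x}(\mathcal G,\bigcup_{\beta<\alpha}\mathcal Y_\beta)$, $\mathcal Z_\alpha=\mathrm{Force}^x(\mathcal G\ominus\mathcal X_\alpha,\{s\in S\setminus\mathcal X_\alpha:\mathrm{Col}(s)=n\})$, $\mathcal Y_\alpha=\mathcal X_\alpha\cup\mathcal C_{n-1}(\mathcal G\ominus\mathcal X_\alpha\ominus\mathcal Z_\alpha)$ (the sub-games are well defined, the last of rank $n-1$), and $\mathcal C_n(\mathcal G)=S\setminus\mathcal X_\gamma$ for the least $\gamma$ with $\mathcal X_{\gamma+1}=\mathcal X_\gamma$. -}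

module Defs where

open import Level using (0ℓ; Lift) renaming (suc to lsuc)
open import Data.Nat using (ℕ; zero; suc; _≤_)
open import Data.Product using (Σ; ∃; _×_; _,_)
open import Relation.Binary.PropositionalEquality using (_≡_)
open import Relation.Binary.Definitions using (Transitive; Trichotomous)
open import Induction.WellFounded using (WellFounded)
open import Relation.Unary using (Pred; _≐_; _∪_; _∖_)
open import Relation.Nullary using (¬_)

data Player : Set where
  P0 P1 : Player

other : Player → Player
other P0 = P1
other P1 = P0

parity : ℕ → Player
parity zero    = P0
parity (suc n) = other (parity n)

data Owner : Set where
  pl  : Player → Owner
  rnd : Owner

-- The probability function P is omitted.
record Game : Set₁ where
  field
    S      : Set
    owner  : S → Owner
    _⟶_    : S → S → Set
    Col    : S → ℕ
    hasSucc       : ∀ s → ∃ λ s' → s ⟶ s'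
    countableSucc : ∀ s → ∃ λ (f : ℕ → S) →
                      (∀ k → s ⟶ f k) × (∀ s' → s ⟶ s' → ∃ λ k → f k ≡ s')

IsRank : Game → ℕ → Set
IsRank G n = ∀ s → Game.Col G s ≤ n

-- Sub-games G ⊖ Q ⊖ ... are represented by the predicate D ⊆ S of their
-- states; transitions/owners/colours are those of G restricted to D.
module _ (G : Game) where
  open Game G

  SinkFree : Pred S 0ℓ → Pred S 0ℓ → Set
  SinkFree D Q = ∀ s → Q s → ∃ λ s' → Q s' × s ⟶ s'

  Closable : Pred S 0ℓ → Pred S 0ℓ → Set
  Closable D Q = (∀ s → Q s → D s) × SinkFree D Q
               × (∀ s s' → Q s → owner s ≡ rnd → D s' → s ⟶ s' → Q s')

  IsTrap : Pred S 0ℓ → Player → Pred S 0ℓ → Set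
  IsTrap D y Q = Closable D Q
               × (∀ s s' → Q s → owner s ≡ pl y → D s' → s ⟶ s' → Q s')

  -- Force^y(G', T) in the sub-game G' with states D: the union of the
  -- transfinite sequence R_α, i.e. the least set containing T (∩ D) and
  -- closed under the one-step operator; rendered as an inductive predicate.
  data Force (D : Pred S 0ℓ) (y : Player) (T : Pred S 0ℓ) : Pred S 0ℓ where
    base : ∀ {s} → D s → T s → Force D y T s
    rand : ∀ {s s'} → D s → owner s ≡ rnd → D s' → s ⟶ s' →
           Force D y T s' → Force D y T s
    own  : ∀ {s s'} → D s → owner s ≡ pl y → D s' → s ⟶ s' →
           Force D y T s' → Force D y T s
    opp  : ∀ {s} → D s → owner s ≡ pl (other y) →
           (∀ s' → D s' → s ⟶ s' → Force D y T s') → Force D y T s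

-- A well-order (index set for transfinite sequences; ordinal-like).
record WellOrder : Set₁ where
  field
    I     : Set
    _<_   : I → I → Set
    wf    : WellFounded _<_
    trans : Transitive _<_
    tri   : Trichotomous _≡_ _<_

  IsSucc : I → I → Set
  IsSucc α β = α < β × (∀ ε → ¬ (α < ε × ε < β))

-- IsC G n D C : "C = C_n(G') where G' is the sub-game of G with states D".
-- For n ≥ 1 the transfinite sequences X_α, Y_α, Z_α are indexed by a
-- well-order W, γ is the least index with X_{γ+1} = X_γ.
IsC : (G : Game) → ℕ → Pred (Game.S G) 0ℓ → Pred (Game.S G) 0ℓ → Set₁
IsC G zero    D C = Lift (lsuc 0ℓ) (C ≐ D)
IsC G (suc m) D C =
  Σ WellOrder λ W → let open WellOrder W in
  Σ (I → Pred S 0ℓ) λ X → Σ (I → Pred S 0ℓ) λ Y → Σ (I → Pred S 0ℓ) λ Z →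
  Σ I λ γ → Σ I λ γ+1 →
    (∀ α → X α ≐ Force G D (other x) (λ s → ∃ λ β → β < α × Y β s))
  × (∀ α → Z α ≐ Force G (D ∖ X α) x (λ s → Col s ≡ n))
  × (∀ α → ∃ λ C' → IsC G m ((D ∖ X α) ∖ Z α) C' × (Y α ≐ (X α ∪ C')))
  × IsSucc γ γ+1
  × (X γ+1 ≐ X γ)
  × (∀ α α+1 → IsSucc α α+1 → X α+1 ≐ X α → ¬ (α < γ))
  × (C ≐ (D ∖ X γ))
  where
    open Game G
    n = suc m
    x = parity n

module Submission where

-- For n = 0, C_0(G) is the whole state space, and a sink-free set of states
-- is trivially a trap of the sub-game it spans.  For n ≥ 1, C_n(G) is by
-- definition S ∖ X_γ, and X_γ is the (1-x)-attractor
-- Force^{1-x}(G, ⋃_{β<γ} Y_β).  The theorem therefore follows from one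
-- general fact about attractors: in a sub-game with sink-free state set D,
-- the complement D ∖ Force^y(D, T) of a y-attractor is a y-trap, for every
-- player y and target T.  Random and y-owned states outside the attractor
-- have all their successors outside it (else the attractor would absorb
-- them); an opponent-owned state outside it has some successor outside it,
-- found by excluded middle (else the opponent rule would absorb it).
-- Traps are invariant under extensional equality of state sets, which is
-- how the two cases are transported to the set C given by the statement.

open import Defs
open import Level using (0ℓ; lift)
open import Data.Nat using (ℕ; zero; suc)
open import Data.Unit using (⊤; tt)
open import Data.Product using (∃; _×_; _,_; proj₁)
open import Data.Sum using (_⊎_; inj₁; inj₂)
open import Data.Empty using (⊥-elim)
open import Relation.Nullary using (¬_; yes; no)
open import Relation.Binary.PropositionalEquality using (_≡_; refl; subst)
open import Relation.Unary using (Pred; _≐_; _∖_)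
open import Relation.Unary.Properties using (≐-sym; ≐-trans)
open import Axiom.ExcludedMiddle using (ExcludedMiddle)

player-dichotomy : ∀ z y → z ≡ y ⊎ z ≡ other y
player-dichotomy P0 P0 = inj₁ refl
player-dichotomy P0 P1 = inj₂ refl
player-dichotomy P1 P0 = inj₂ refl
player-dichotomy P1 P1 = inj₁ refl

∖-congʳ : ∀ {A : Set} {D P Q : Pred A 0ℓ} → P ≐ Q → (D ∖ P) ≐ (D ∖ Q)
∖-congʳ (P⊆Q , Q⊆P) = (λ (d , ¬p) → d , λ q → ¬p (Q⊆P q))
                    , (λ (d , ¬q) → d , λ p → ¬q (P⊆Q p))

module _ (G : Game) where
  open Game G

  trap-resp-≐ : ∀ {D y Q Q'} → Q ≐ Q' → IsTrap G D y Q → IsTrap G D y Q'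
  trap-resp-≐ (Q⊆Q' , Q'⊆Q) ((inD , sinkFree , randClosed) , ownClosed) =
      ((λ s q → inD s (Q'⊆Q q))
    , (λ s q → let (s' , q' , st) = sinkFree s (Q'⊆Q q) in s' , Q⊆Q' q' , st)
    , (λ s s' q r d st → Q⊆Q' (randClosed s s' (Q'⊆Q q) r d st)))
    , (λ s s' q o d st → Q⊆Q' (ownClosed s s' (Q'⊆Q q) o d st))

  sinkFree-self-trap : ∀ {D} y → SinkFree G D D → IsTrap G D y D
  sinkFree-self-trap y sinkFree =
    ((λ _ d → d) , sinkFree , (λ _ _ _ _ d _ → d)) , (λ _ _ _ _ d _ → d)

  everything-sinkFree : SinkFree G (λ _ → ⊤) (λ _ → ⊤)
  everything-sinkFree s _ = let (s' , st) = hasSucc s in s' , tt , st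

  attractor-complement-trap : ExcludedMiddle 0ℓ →
    ∀ {D} y T → SinkFree G D D → IsTrap G D y (D ∖ Force G D y T)
  attractor-complement-trap em {D} y T sinkFreeD =
    ((λ _ → proj₁) , sinkFree , randClosed) , ownClosed
    where
    F = Force G D y T

    randClosed : ∀ s s' → (D ∖ F) s → owner s ≡ rnd → D s' → s ⟶ s' →
                 (D ∖ F) s'
    randClosed s s' (d , ¬f) r d' st = d' , λ f → ¬f (rand d r d' st f)

    ownClosed : ∀ s s' → (D ∖ F) s → owner s ≡ pl y → D s' → s ⟶ s' →
                (D ∖ F) s'
    ownClosed s s' (d , ¬f) o d' st = d' , λ f → ¬f (own d o d' st f)

    -- An opponent state all of whose successors in D lie in F is in F, so
    -- an opponent state outside F has a successor in D ∖ F.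
    escape : ∀ s → (D ∖ F) s → owner s ≡ pl (other y) →
             ∃ λ s' → (D ∖ F) s' × s ⟶ s'
    escape s (d , ¬f) o with em {∃ λ s' → (D ∖ F) s' × s ⟶ s'}
    ... | yes out = out
    ... | no noExit = ⊥-elim (¬f (opp d o allInF))
      where
      allInF : ∀ s' → D s' → s ⟶ s' → F s'
      allInF s' d' st with em {F s'}
      ... | yes f  = f
      ... | no ¬f' = ⊥-elim (noExit (s' , (d' , ¬f') , st))

    anySucc : ∀ s → (D ∖ F) s →
              (∀ s' → D s' → s ⟶ s' → (D ∖ F) s') →
              ∃ λ s' → (D ∖ F) s' × s ⟶ s'
    anySucc s (d , _) closed =
      let (s' , d' , st) = sinkFreeD s d in s' , closed s' d' st , st

    sinkFree : SinkFree G D (D ∖ F)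
    sinkFree s q with owner s in eq
    ... | rnd  = anySucc s q (λ s' → randClosed s s' q eq)
    ... | pl z with player-dichotomy z y
    ...   | inj₁ refl = anySucc s q (λ s' → ownClosed s s' q eq)
    ...   | inj₂ z≡ȳ  = escape s q (subst (λ w → owner s ≡ pl w) z≡ȳ eq)

lemma5p6 : ExcludedMiddle 0ℓ → (G : Game) (n : ℕ) → IsRank G n →
           (C : Pred (Game.S G) 0ℓ) → IsC G n (λ _ → ⊤) C →
           IsTrap G (λ _ → ⊤) (other (parity n)) C
-- C_0(G) = S.
lemma5p6 _ G zero _ C (lift C≐S) =
  trap-resp-≐ G (≐-sym C≐S)
    (sinkFree-self-trap G _ (everything-sinkFree G))
lemma5p6 em G (suc m) _ C
         (_ , _ , _ , _ , γ , _ , X≐Force , _ , _ , _ , _ , _ , C≐S∖Xγ) =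
  trap-resp-≐ G (≐-sym (≐-trans C≐S∖Xγ (∖-congʳ (X≐Force γ))))
    (attractor-complement-trap G em _ _ (everything-sinkFree G))
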